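{- Let $G$ be a connected finite simple graph of order $n$, and let $\mathcal C$ be the collection of all nonempty connected sets of $G$. Then \[\sum_{U \in \mathcal C} |U|^2 \geq \left(\frac{n+1}{2}\right) S(G), \qquad \text{where } S(G) = \sum_{U \in \mathcal C} |U|.\]
   Context: For a finite simple graph $G$ with vertex set $V$, a set $U \subseteq V$ is a connected set if the subgraph of $G$ induced by $U$ is connected. The collection $\mathcal C$ consists of all such sets excluding the empty set. -}

module Defs where

open import Data.Nat using (ℕ; _+_; _*_; _≤_)
open import Data.Bool using (Bool; true; false)
open import Data.Fin using (Fin)
open import Data.Fin.Subset using (Subset; _∈_; ∣_∣; Nonempty; ⊤)
open import Data.List using (List; map)
open import Data.Nat.ListAction using (sum)
open import Data.List.Membership.Propositional renaming (_∈_ to _∈ₗ_)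
open import Data.List.Relation.Unary.Unique.Propositional using (Unique)
open import Data.Product using (_×_)
open import Function.Bundles using (_⇔_)
open import Relation.Binary.PropositionalEquality using (_≡_)

record Graph (n : ℕ) : Set where
  field
    adj   : Fin n → Fin n → Bool
    sym   : ∀ u v → adj u v ≡ adj v u
    irrefl : ∀ u → adj u u ≡ false
open Graph public

data WalkIn {n : ℕ} (G : Graph n) (U : Subset n) : Fin n → Fin n → Set where
  stop : ∀ {u} → u ∈ U → WalkIn G U u u
  step : ∀ {u v w} → u ∈ U → adj G u v ≡ true → WalkIn G U v w → WalkIn G U u w

InducedConnected : {n : ℕ} → Graph n → Subset n → Set
InducedConnected G U = ∀ u v → u ∈ U → v ∈ U → WalkIn G U u v

IsConnectedSet : {n : ℕ} → Graph n → Subset n → Set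
IsConnectedSet G U = Nonempty U × InducedConnected G U

ConnectedGraph : {n : ℕ} → Graph n → Set
ConnectedGraph G = InducedConnected G ⊤

Enumerates : {n : ℕ} → Graph n → List (Subset n) → Set
Enumerates G L = Unique L × (∀ U → (U ∈ₗ L) ⇔ IsConnectedSet G U)

sumSizes : {n : ℕ} → List (Subset n) → ℕ
sumSizes L = sum (map ∣_∣ L)

sumSqSizes : {n : ℕ} → List (Subset n) → ℕ
sumSqSizes L = sum (map (λ U → ∣ U ∣ * ∣ U ∣) L)

{-# OPTIONS --safe #-}
-- For a nonempty connected set K inside a connected set D, let N(K,D) and S(K,D) be the number and the
-- total size of the connected sets U with K ⊆ U ⊆ D. The key inequality is (|K| + |D|)·N(K,D) ≤ 2·S(K,D):
-- on average such a U is at least as large as the mean of K and D. Taking K = {v}, D = V and summing over v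
-- gives the theorem, because Σ_v N({v},V) = Σ_U |U| and Σ_v S({v},V) = Σ_U |U|².
--
-- If D ≠ K, pick x ∈ D ∖ K adjacent to K. The sets containing x lie
-- between K ∪ {x} and D; those avoiding x lie between K and R, the largest connected set between K and
-- D − x. Both families obey the inequality by induction, and what remains is
-- (|D| − |R|)·N(K,R) ≤ N(K ∪ {x}, D). For this, grow a connected Q from {x} inside D ∖ R one neighbour y
-- at a time (maximality of R forces y to attach to Q, not to R); at each stage U ↦ U ∪ Q injects the sets
-- between K and R into those between K ∪ Q and D − y, and these families are disjoint as Q grows.
module Submission where

open import Defs hiding (sym)
open import Data.Bool using (true; if_then_else_)
open import Data.Empty using (⊥-elim)
open import Data.Fin using (Fin; suc)
open import Data.Fin.Properties using (¬∀⟶∃¬)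
open import Data.Fin.Subset
open import Data.Fin.Subset.Properties
open import Data.Fin.Subset.Induction using (Acc; acc; ⊂-wellFounded; ⊃-wellFounded)
open import Data.List using (List; []; _∷_; map; length; filter; foldr; allFin; tabulate)
open import Data.List.Properties using (map-tabulate; length-removeAt′)
open import Data.List.Membership.Propositional using () renaming (_∈_ to _∈ₗ_)
open import Data.List.Membership.Propositional.Properties using (∈-filter⁺; ∈-filter⁻)
open import Data.List.Relation.Unary.All as All using (All; []; _∷_)
open import Data.List.Relation.Unary.Any using (here; there; index) renaming (_─_ to _─ₗ_)
open import Data.List.Relation.Unary.AllPairs using (_∷_)
open import Data.List.Relation.Unary.Unique.Propositional using (Unique)
open import Data.List.Relation.Unary.Unique.Propositional.Properties using (filter⁺)
open import Data.Nat using (ℕ; suc; _+_; _*_; _≤_; _<_; z≤n; s≤s)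
open import Data.Nat.ListAction using (sum)
open import Data.Nat.Properties
open import Algebra.Properties.CommutativeSemigroup +-commutativeSemigroup using (interchange; x∙yz≈y∙xz)
open import Data.Nat.Tactic.RingSolver using (solve-∀)
open import Data.Product using (∃; _×_; _,_; proj₁; proj₂)
open import Data.Vec using ([]; _∷_; here; there)
open import Data.Sum using (_⊎_; inj₁; inj₂; [_,_]′)
open import Function using (_∘_; id)
open import Function.Bundles using (_⇔_; mk⇔; Equivalence)
open import Relation.Nullary using (Dec; yes; no; ¬_; does)
open import Relation.Nullary.Decidable using (_×-dec_; _→-dec_; decidable-stable)
open import Relation.Unary using (Decidable)
open import Relation.Binary.PropositionalEquality

module _ {A : Set} where

  sum-map-cong : (xs : List A) {f g : A → ℕ} → (∀ {a} → a ∈ₗ xs → f a ≡ g a) →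
                 sum (map f xs) ≡ sum (map g xs)
  sum-map-cong []       f≗g = refl
  sum-map-cong (x ∷ xs) f≗g = cong₂ _+_ (f≗g (here refl)) (sum-map-cong xs (f≗g ∘ there))

  sum-map-mono : (xs : List A) {f g : A → ℕ} → (∀ {a} → a ∈ₗ xs → f a ≤ g a) →
                 sum (map f xs) ≤ sum (map g xs)
  sum-map-mono []       f≤g = z≤n
  sum-map-mono (x ∷ xs) f≤g = +-mono-≤ (f≤g (here refl)) (sum-map-mono xs (f≤g ∘ there))

  sum-map-+ : (xs : List A) (f g : A → ℕ) →
              sum (map (λ a → f a + g a) xs) ≡ sum (map f xs) + sum (map g xs)
  sum-map-+ []       f g = refl
  sum-map-+ (x ∷ xs) f g =
    trans (cong (f x + g x +_) (sum-map-+ xs f g)) (interchange (f x) (g x) _ _)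

  *-sum-map : (c : ℕ) (xs : List A) (f : A → ℕ) →
              c * sum (map f xs) ≡ sum (map (λ a → c * f a) xs)
  *-sum-map c []       f = *-zeroʳ c
  *-sum-map c (x ∷ xs) f =
    trans (*-distribˡ-+ c (f x) _) (cong (c * f x +_) (*-sum-map c xs f))

  sum-map-* : (c : ℕ) (xs : List A) (f : A → ℕ) →
              sum (map f xs) * c ≡ sum (map (λ a → f a * c) xs)
  sum-map-* c []       f = refl
  sum-map-* c (x ∷ xs) f =
    trans (*-distribʳ-+ c (f x) _) (cong (f x * c +_) (sum-map-* c xs f))

module _ {A B : Set} where

  sum-map-comm : (xs : List A) (ys : List B) (h : A → B → ℕ) →
                 sum (map (λ a → sum (map (h a) ys)) xs) ≡ sum (map (λ b → sum (map (λ a → h a b) xs)) ys)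
  sum-map-comm []       ys h = *-sum-map 0 ys (λ _ → 0)
  sum-map-comm (x ∷ xs) ys h =
    trans (cong (sum (map (h x) ys) +_) (sum-map-comm xs ys h))
          (sym (sum-map-+ ys (h x) (λ b → sum (map (λ a → h a b) xs))))

𝟙 : {P : Set} → Dec P → ℕ
𝟙 d = if does d then 1 else 0

𝟙-⇔ : {P Q : Set} → P ⇔ Q → (p : Dec P) (q : Dec Q) → 𝟙 p ≡ 𝟙 q
𝟙-⇔ P⇔Q (yes _) (yes _) = refl
𝟙-⇔ P⇔Q (yes p) (no ¬q) = ⊥-elim (¬q (Equivalence.to P⇔Q p))
𝟙-⇔ P⇔Q (no ¬p) (yes q) = ⊥-elim (¬p (Equivalence.from P⇔Q q))
𝟙-⇔ P⇔Q (no _)  (no _)  = refl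

𝟙-⊎ : {P Q R : Set} → (P → Q ⊎ R) → (Q → P) → (R → P) → ¬ (Q × R) →
      (p : Dec P) (q : Dec Q) (r : Dec R) → 𝟙 p ≡ 𝟙 q + 𝟙 r
𝟙-⊎ _  _   _   Q#R _       (yes q) (yes r) = ⊥-elim (Q#R (q , r))
𝟙-⊎ _  _   _   _   (yes _) (yes _) (no _)  = refl
𝟙-⊎ _  Q⇒P _   _   (no ¬p) (yes q) (no _)  = ⊥-elim (¬p (Q⇒P q))
𝟙-⊎ _  _   _   _   (yes _) (no _)  (yes _) = refl
𝟙-⊎ _  _   R⇒P _   (no ¬p) (no _)  (yes r) = ⊥-elim (¬p (R⇒P r))
𝟙-⊎ P⇒ _   _   _   (yes p) (no ¬q) (no ¬r) = ⊥-elim ([ ¬q , ¬r ]′ (P⇒ p))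
𝟙-⊎ _  _   _   _   (no _)  (no _)  (no _)  = refl

module _ {A : Set} {P : A → Set} (P? : Decidable P) where

  sumWhere : (A → ℕ) → List A → ℕ
  sumWhere w xs = sum (map (λ a → 𝟙 (P? a) * w a) xs)

  countWhere : List A → ℕ
  countWhere = sumWhere (λ _ → 1)

  countWhere≡length∘filter : (xs : List A) → countWhere xs ≡ length (filter P? xs)
  countWhere≡length∘filter []       = refl
  countWhere≡length∘filter (x ∷ xs) with P? x
  ... | yes _ = cong suc (countWhere≡length∘filter xs)
  ... | no  _ = countWhere≡length∘filter xs

  *-countWhere≤*-sumWhere : (xs : List A) (w : A → ℕ) (c d : ℕ) →
                            (∀ {a} → a ∈ₗ xs → P a → c ≤ d * w a) →
                            c * countWhere xs ≤ d * sumWhere w xs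
  *-countWhere≤*-sumWhere xs w c d bound = begin
    c * countWhere xs                       ≡⟨ *-sum-map c xs _ ⟩
    sum (map (λ a → c * (𝟙 (P? a) * 1)) xs)   ≤⟨ sum-map-mono xs pointwise ⟩
    sum (map (λ a → d * (𝟙 (P? a) * w a)) xs) ≡⟨ *-sum-map d xs _ ⟨
    d * sumWhere w xs                       ∎
    where
    open ≤-Reasoning
    pointwise : ∀ {a} → a ∈ₗ xs → c * (𝟙 (P? a) * 1) ≤ d * (𝟙 (P? a) * w a)
    pointwise {a} a∈xs with P? a
    ... | yes Pa = begin
      c * 1         ≡⟨ *-identityʳ c ⟩
      c             ≤⟨ bound a∈xs Pa ⟩
      d * w a       ≡⟨ cong (d *_) (+-identityʳ (w a)) ⟨
      d * (1 * w a) ∎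
    ... | no  _  = ≤-reflexive (trans (*-zeroʳ c) (sym (*-zeroʳ d)))

module _ {A : Set} {P Q R : A → Set} (P? : Decidable P) (Q? : Decidable Q) (R? : Decidable R) where

  sumWhere-⊎ : (∀ {a} → P a → Q a ⊎ R a) → (∀ {a} → Q a → P a) → (∀ {a} → R a → P a) →
               (∀ {a} → ¬ (Q a × R a)) → (w : A → ℕ) (xs : List A) →
               sumWhere P? w xs ≡ sumWhere Q? w xs + sumWhere R? w xs
  sumWhere-⊎ P⇒ Q⇒P R⇒P Q#R w xs =
    trans (sum-map-cong xs λ {a} _ →
             trans (cong (_* w a) (𝟙-⊎ P⇒ Q⇒P R⇒P Q#R (P? a) (Q? a) (R? a)))
                   (*-distribʳ-+ (w a) (𝟙 (Q? a)) (𝟙 (R? a))))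
          (sum-map-+ xs _ _)

module _ {A : Set} {P Q : A → Set} (P? : Decidable P) (Q? : Decidable Q) where

  sumWhere-cong : (w : A → ℕ) (xs : List A) → (∀ {a} → a ∈ₗ xs → P a ⇔ Q a) →
                  sumWhere P? w xs ≡ sumWhere Q? w xs
  sumWhere-cong w xs P⇔Q = sum-map-cong xs λ {a} a∈xs → cong (_* w a) (𝟙-⇔ (P⇔Q a∈xs) (P? a) (Q? a))

-- Holds by computation: suc v ∈? s ∷ p is v ∈? p with its evidence transported, and 𝟙 reads only does.
𝟙[∈]-allFin-suc : ∀ {n s} (p : Subset n) →
                  map (λ v → 𝟙 (v ∈? p)) (allFin n) ≡ map (λ v → 𝟙 (v ∈? s ∷ p)) (tabulate suc)
𝟙[∈]-allFin-suc p = trans (map-tabulate id (λ v → 𝟙 (v ∈? p))) (sym (map-tabulate suc _))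

∣p∣≡Σ𝟙[∈p] : ∀ {n} (p : Subset n) → ∣ p ∣ ≡ sum (map (λ v → 𝟙 (v ∈? p)) (allFin n))
∣p∣≡Σ𝟙[∈p] []            = refl
∣p∣≡Σ𝟙[∈p] (inside  ∷ p) = cong suc (trans (∣p∣≡Σ𝟙[∈p] p) (cong sum (𝟙[∈]-allFin-suc p)))
∣p∣≡Σ𝟙[∈p] (outside ∷ p) = trans (∣p∣≡Σ𝟙[∈p] p) (cong sum (𝟙[∈]-allFin-suc p))

module _ {A B : Set} where

  ∈-─ₗ⁺ : {ys : List B} {b c : B} (c∈ys : c ∈ₗ ys) → b ∈ₗ ys → b ≢ c → b ∈ₗ (ys ─ₗ c∈ys)
  ∈-─ₗ⁺ (here refl) (here refl) b≢c = ⊥-elim (b≢c refl)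
  ∈-─ₗ⁺ (here refl) (there b∈ys) b≢c = b∈ys
  ∈-─ₗ⁺ (there c∈ys) (here refl) b≢c = here refl
  ∈-─ₗ⁺ (there c∈ys) (there b∈ys) b≢c = there (∈-─ₗ⁺ c∈ys b∈ys b≢c)

  length-≤-injection : (f : A → B) {xs : List A} → Unique xs →
                       (∀ {a a′} → a ∈ₗ xs → a′ ∈ₗ xs → f a ≡ f a′ → a ≡ a′) →
                       {ys : List B} → (∀ {a} → a ∈ₗ xs → f a ∈ₗ ys) → length xs ≤ length ys
  length-≤-injection f {[]}     _                 _   _     = z≤n
  length-≤-injection f {x ∷ xs} (x∉xs ∷ xs-uniq) inj {ys} f∈ys
    rewrite length-removeAt′ ys (index (f∈ys (here refl))) =
    s≤s (length-≤-injection f xs-uniq (λ p q → inj (there p) (there q))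
           λ a∈xs → ∈-─ₗ⁺ (f∈ys (here refl)) (f∈ys (there a∈xs))
                      λ fa≡fx → All.lookup x∉xs a∈xs (sym (inj (there a∈xs) (here refl) fa≡fx)))

module _ {A : Set} {P Q : A → Set} (P? : Decidable P) (Q? : Decidable Q) where

  countWhere-≤-injection : (f : A → A) {xs : List A} → Unique xs →
                           (∀ {a} → a ∈ₗ xs → P a → f a ∈ₗ xs × Q (f a)) →
                           (∀ {a a′} → a ∈ₗ xs → a′ ∈ₗ xs → P a → P a′ → f a ≡ f a′ → a ≡ a′) →
                           countWhere P? xs ≤ countWhere Q? xs
  countWhere-≤-injection f {xs} xs-uniq maps-to inj
    rewrite countWhere≡length∘filter P? xs | countWhere≡length∘filter Q? xs =
    length-≤-injection f (filter⁺ P? xs-uniq)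
      (λ p q → let (a∈ , Pa) = ∈-filter⁻ P? p ; (a′∈ , Pa′) = ∈-filter⁻ P? q in inj a∈ a′∈ Pa Pa′)
      (λ p → let (a∈ , Pa) = ∈-filter⁻ P? p ; (fa∈ , Qfa) = maps-to a∈ Pa in ∈-filter⁺ Q? fa∈ Qfa)

x∈p─q⇒x∉q : ∀ {n} {x : Fin n} (p q : Subset n) → x ∈ p ─ q → x ∉ q
x∈p─q⇒x∉q (inside ∷ p) (outside ∷ q) here      ()
x∈p─q⇒x∉q (_ ∷ p)      (_ ∷ q)       (there x∈) (there x∈q) = x∈p─q⇒x∉q p q x∈ x∈q

∣p∪q∣≤∣p∣+∣q∣ : ∀ {n} (p q : Subset n) → ∣ p ∪ q ∣ ≤ ∣ p ∣ + ∣ q ∣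
∣p∪q∣≤∣p∣+∣q∣ []            []            = z≤n
∣p∪q∣≤∣p∣+∣q∣ (inside  ∷ p) (inside  ∷ q) = s≤s (≤-trans (∣p∪q∣≤∣p∣+∣q∣ p q) (+-monoʳ-≤ ∣ p ∣ (n≤1+n ∣ q ∣)))
∣p∪q∣≤∣p∣+∣q∣ (inside  ∷ p) (outside ∷ q) = s≤s (∣p∪q∣≤∣p∣+∣q∣ p q)
∣p∪q∣≤∣p∣+∣q∣ (outside ∷ p) (inside  ∷ q) = ≤-trans (s≤s (∣p∪q∣≤∣p∣+∣q∣ p q)) (≤-reflexive (sym (+-suc ∣ p ∣ ∣ q ∣)))
∣p∪q∣≤∣p∣+∣q∣ (outside ∷ p) (outside ∷ q) = ∣p∪q∣≤∣p∣+∣q∣ p q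

module _ {n : ℕ} where

  ∪-least : {p q r : Subset n} → p ⊆ r → q ⊆ r → p ∪ q ⊆ r
  ∪-least {p} {q} p⊆r q⊆r x∈p∪q with x∈p∪q⁻ p q x∈p∪q
  ... | inj₁ x∈p = p⊆r x∈p
  ... | inj₂ x∈q = q⊆r x∈q

  x∈p⇒⁅x⁆⊆p : {x : Fin n} {p : Subset n} → x ∈ p → ⁅ x ⁆ ⊆ p
  x∈p⇒⁅x⁆⊆p {x} x∈p y∈⁅x⁆ rewrite x∈⁅y⁆⇒x≡y x y∈⁅x⁆ = x∈p

  p⊂p∪⁅x⁆ : {x : Fin n} {p : Subset n} → x ∉ p → p ⊂ p ∪ ⁅ x ⁆
  p⊂p∪⁅x⁆ {x} {p} x∉p = p⊆p∪q ⁅ x ⁆ , x , q⊆p∪q p ⁅ x ⁆ (x∈⁅x⁆ x) , x∉p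

  x∈p-y⇒x≢y : {x y : Fin n} (p : Subset n) → x ∈ p - y → x ≢ y
  x∈p-y⇒x≢y {y = y} p x∈p-y refl = x∈p─q⇒x∉q p ⁅ y ⁆ x∈p-y (x∈⁅x⁆ y)

  p⊆q⇒p⊆q-x : {x : Fin n} {p q : Subset n} → p ⊆ q → x ∉ p → p ⊆ q - x
  p⊆q⇒p⊆q-x p⊆q x∉p y∈p = x∈p∧x≢y⇒x∈p-y (p⊆q y∈p) λ { refl → x∉p y∈p }

  p⊆q-x⇒x∉p : {x : Fin n} {p q : Subset n} → p ⊆ q - x → x ∉ p
  p⊆q-x⇒x∉p {q = q} p⊆q-x x∈p = x∈p-y⇒x≢y q (p⊆q-x x∈p) refl

  p⊆q-x⇒p⊂q : {x : Fin n} {p q : Subset n} → p ⊆ q - x → x ∈ q → p ⊂ q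
  p⊆q-x⇒p⊂q {x} {q = q} p⊆q-x x∈q = p─q⊆p q ⁅ x ⁆ ∘ p⊆q-x , x , x∈q , p⊆q-x⇒x∉p p⊆q-x

  p∪r≡q∪r⇒p⊆q : {p q r : Subset n} → p ∪ r ≡ q ∪ r → (∀ {x} → x ∈ p → x ∉ r) → p ⊆ q
  p∪r≡q∪r⇒p⊆q {p} {q} {r} p∪r≡q∪r p#r {x} x∈p with x∈p∪q⁻ q r (subst (x ∈_) p∪r≡q∪r (p⊆p∪q r x∈p))
  ... | inj₁ x∈q = x∈q
  ... | inj₂ x∈r = ⊥-elim (p#r x∈p x∈r)

  ⊆-or-∉ : (p q : Subset n) → p ⊆ q ⊎ ∃ λ x → x ∈ p × x ∉ q
  ⊆-or-∉ p q with p ⊆? q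
  ... | yes p⊆q = inj₁ p⊆q
  ... | no  p⊈q with ¬∀⟶∃¬ n (λ x → x ∈ p → x ∈ q) (λ x → x ∈? p →-dec x ∈? q) (λ ∀x → p⊈q (∀x _))
  ... | x , ¬[x∈p⇒x∈q] =
    inj₂ (x , decidable-stable (x ∈? p) (λ x∉p → ¬[x∈p⇒x∈q] (⊥-elim ∘ x∉p)) , ¬[x∈p⇒x∈q] ∘ λ x∈q _ → x∈q)

  ⊆-foldr-∪ : {p : Subset n} (qs : List (Subset n)) → p ⊆ foldr _∪_ p qs
  ⊆-foldr-∪ []       = id
  ⊆-foldr-∪ (q ∷ qs) = q⊆p∪q q _ ∘ ⊆-foldr-∪ qs

  ∈⇒⊆-foldr-∪ : {p q : Subset n} {qs : List (Subset n)} → q ∈ₗ qs → q ⊆ foldr _∪_ p qs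
  ∈⇒⊆-foldr-∪ {qs = q ∷ qs} (here refl)  = p⊆p∪q _
  ∈⇒⊆-foldr-∪ {qs = q ∷ qs} (there q∈qs) = q⊆p∪q q _ ∘ ∈⇒⊆-foldr-∪ q∈qs

  foldr-∪-⊆ : {p r : Subset n} {qs : List (Subset n)} → p ⊆ r → All (_⊆ r) qs → foldr _∪_ p qs ⊆ r
  foldr-∪-⊆ p⊆r []            = p⊆r
  foldr-∪-⊆ p⊆r (q⊆r ∷ qs⊆r) = ∪-least q⊆r (foldr-∪-⊆ p⊆r qs⊆r)

module _ {n : ℕ} (G : Graph n) where

  private
    Connected : Subset n → Set
    Connected = InducedConnected G

  walk-head : ∀ {U a b} → WalkIn G U a b → a ∈ U
  walk-head (stop a∈U)     = a∈U
  walk-head (step a∈U _ _) = a∈U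

  walk-mono : ∀ {U W a b} → U ⊆ W → WalkIn G U a b → WalkIn G W a b
  walk-mono U⊆W (stop a∈U)       = stop (U⊆W a∈U)
  walk-mono U⊆W (step a∈U ab bc) = step (U⊆W a∈U) ab (walk-mono U⊆W bc)

  walk-++ : ∀ {U a b c} → WalkIn G U a b → WalkIn G U b c → WalkIn G U a c
  walk-++ (stop _)         w = w
  walk-++ (step a∈U ab bc) w = step a∈U ab (walk-++ bc w)

  walk-reverse : ∀ {U a b} → WalkIn G U a b → WalkIn G U b a
  walk-reverse (stop a∈U)       = stop a∈U
  walk-reverse (step a∈U ab bc) =
    walk-++ (walk-reverse bc) (step (walk-head bc) (trans (Graph.sym G _ _) ab) (stop a∈U))

  private
    walk-∪ˡ : ∀ {U W c d} → WalkIn G U c d → WalkIn G (U ∪ W) c d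
    walk-∪ˡ {W = W} = walk-mono (p⊆p∪q W)
    walk-∪ʳ : ∀ {U W c d} → WalkIn G W c d → WalkIn G (U ∪ W) c d
    walk-∪ʳ {U} {W} = walk-mono (q⊆p∪q U W)

  connected-∪ : ∀ {U W a b} → Connected U → Connected W → a ∈ U → b ∈ W →
                WalkIn G (U ∪ W) a b → Connected (U ∪ W)
  connected-∪ {U} {W} {a} {b} cU cW a∈U b∈W a⇝b u v u∈ v∈
    with x∈p∪q⁻ U W u∈ | x∈p∪q⁻ U W v∈
  ... | inj₁ u∈U | inj₁ v∈U = walk-∪ˡ (cU u v u∈U v∈U)
  ... | inj₂ u∈W | inj₂ v∈W = walk-∪ʳ (cW u v u∈W v∈W)
  ... | inj₁ u∈U | inj₂ v∈W = walk-++ (walk-∪ˡ (cU u a u∈U a∈U)) (walk-++ a⇝b (walk-∪ʳ (cW b v b∈W v∈W)))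
  ... | inj₂ u∈W | inj₁ v∈U = walk-++ (walk-∪ʳ (cW u b u∈W b∈W)) (walk-++ (walk-reverse a⇝b) (walk-∪ˡ (cU a v a∈U v∈U)))

  connected-∪-edge : ∀ {U W a b} → Connected U → Connected W → a ∈ U → b ∈ W →
                     adj G a b ≡ true → Connected (U ∪ W)
  connected-∪-edge {U} {W} cU cW a∈U b∈W ab =
    connected-∪ cU cW a∈U b∈W (step (p⊆p∪q W a∈U) ab (stop (q⊆p∪q U W b∈W)))

  connected-∪-common : ∀ {U W a} → Connected U → Connected W → a ∈ U → a ∈ W → Connected (U ∪ W)
  connected-∪-common {U} {W} cU cW a∈U a∈W = connected-∪ cU cW a∈U a∈W (stop (p⊆p∪q W a∈U))

  connected-⁅⁆ : ∀ v → Connected ⁅ v ⁆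
  connected-⁅⁆ v u w u∈ w∈ with refl ← x∈⁅y⁆⇒x≡y v u∈ | refl ← x∈⁅y⁆⇒x≡y v w∈ = stop u∈

  connected-foldr-∪ : ∀ {U a} {Ws : List (Subset n)} → Connected U → a ∈ U →
                      All (λ W → Connected W × a ∈ W) Ws → Connected (foldr _∪_ U Ws)
  connected-foldr-∪ cU a∈U []                = cU
  connected-foldr-∪ {Ws = _ ∷ Ws} cU a∈U ((cW , a∈W) ∷ cWs) =
    connected-∪-common cW (connected-foldr-∪ cU a∈U cWs) a∈W (⊆-foldr-∪ Ws a∈U)

  record Exit (A D : Subset n) : Set where
    constructor exit
    field
      {inner outer} : Fin n
      inner∈A : inner ∈ A
      outer∉A : outer ∉ A
      outer∈D : outer ∈ D
      edge    : adj G inner outer ≡ true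

  walk-exit : ∀ {A D a b} → WalkIn G D a b → a ∈ A → b ∉ A → Exit A D
  walk-exit (stop _)             a∈A a∉A = ⊥-elim (a∉A a∈A)
  walk-exit {A} (step {v = c} _ ac c⇝b) a∈A b∉A with c ∈? A
  ... | yes c∈A = walk-exit c⇝b c∈A b∉A
  ... | no  c∉A = exit a∈A c∉A (walk-head c⇝b) ac

  ⊆-or-exit : ∀ {A D a} → Connected D → a ∈ A → a ∈ D → D ⊆ A ⊎ Exit A D
  ⊆-or-exit {A} {D} cD a∈A a∈D with ⊆-or-∉ D A
  ... | inj₁ D⊆A             = inj₁ D⊆A
  ... | inj₂ (b , b∈D , b∉A) = inj₂ (walk-exit (cD _ b a∈D b∈D) a∈A b∉A)

module ConnectedSets {n : ℕ} (G : Graph n) (L : List (Subset n)) (L-unique : Unique L)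
                     (L-exact : ∀ U → (U ∈ₗ L) ⇔ IsConnectedSet G U) where

  private
    Connected : Subset n → Set
    Connected = InducedConnected G

  ∈L⇒connected : ∀ {U} → U ∈ₗ L → Connected U
  ∈L⇒connected U∈L = proj₂ (Equivalence.to (L-exact _) U∈L)

  connected⇒∈L : ∀ {U u} → u ∈ U → Connected U → U ∈ₗ L
  connected⇒∈L u∈U cU = Equivalence.from (L-exact _) ((_ , u∈U) , cU)

  Between : Subset n → Subset n → Subset n → Set
  Between K D U = K ⊆ U × U ⊆ D

  between? : ∀ K D → Decidable (Between K D)
  between? K D U = K ⊆? U ×-dec U ⊆? D

  mass : (Subset n → ℕ) → Subset n → Subset n → ℕ
  mass w K D = sumWhere (between? K D) w L

  N S : Subset n → Subset n → ℕ
  N = mass (λ _ → 1)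
  S = mass ∣_∣

  mass-split : ∀ w K D x → mass w K D ≡ mass w (K ∪ ⁅ x ⁆) D + mass w K (D - x)
  mass-split w K D x =
    sumWhere-⊎ (between? K D) (between? (K ∪ ⁅ x ⁆) D) (between? K (D - x)) split join₁ join₂ disjoint w L
    where
    split : ∀ {U} → Between K D U → Between (K ∪ ⁅ x ⁆) D U ⊎ Between K (D - x) U
    split {U} (K⊆U , U⊆D) with x ∈? U
    ... | yes x∈U = inj₁ (∪-least K⊆U (x∈p⇒⁅x⁆⊆p x∈U) , U⊆D)
    ... | no  x∉U = inj₂ (K⊆U , p⊆q⇒p⊆q-x U⊆D x∉U)
    join₁ : ∀ {U} → Between (K ∪ ⁅ x ⁆) D U → Between K D U
    join₁ (K∪x⊆U , U⊆D) = K∪x⊆U ∘ p⊆p∪q ⁅ x ⁆ , U⊆D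
    join₂ : ∀ {U} → Between K (D - x) U → Between K D U
    join₂ (K⊆U , U⊆D-x) = K⊆U , p─q⊆p D ⁅ x ⁆ ∘ U⊆D-x
    disjoint : ∀ {U} → ¬ (Between (K ∪ ⁅ x ⁆) D U × Between K (D - x) U)
    disjoint ((K∪x⊆U , _) , (_ , U⊆D-x)) =
      x∈p-y⇒x≢y D (U⊆D-x (K∪x⊆U (q⊆p∪q K ⁅ x ⁆ (x∈⁅x⁆ x)))) refl

  mean-bound-⊇ : ∀ {K D} → D ⊆ K → (∣ K ∣ + ∣ D ∣) * N K D ≤ 2 * S K D
  mean-bound-⊇ {K} {D} D⊆K = *-countWhere≤*-sumWhere (between? K D) L ∣_∣ _ 2 λ {U} _ (K⊆U , _) →
    ≤-trans (+-mono-≤ (p⊆q⇒∣p∣≤∣q∣ K⊆U) (p⊆q⇒∣p∣≤∣q∣ (K⊆U ∘ D⊆K)))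
            (≤-reflexive (cong (∣ U ∣ +_) (sym (+-identityʳ ∣ U ∣))))

  record Largest (K D R : Subset n) : Set where
    field
      connected : Connected R
      K⊆R       : K ⊆ R
      R⊆D       : R ⊆ D
      maximum   : ∀ {U} → Connected U → K ⊆ U → U ⊆ D → U ⊆ R

  largest : ∀ {K D k} → k ∈ K → Connected K → K ⊆ D → ∃ (Largest K D)
  largest {K} {D} k∈K cK K⊆D = foldr _∪_ K Us , record
    { connected = connected-foldr-∪ G cK k∈K (All.tabulate λ U∈Us →
        let U∈L , K⊆U , _ = ∈-filter⁻ (between? K D) U∈Us in ∈L⇒connected U∈L , K⊆U k∈K)
    ; K⊆R       = ⊆-foldr-∪ Us
    ; R⊆D       = foldr-∪-⊆ {qs = Us} K⊆D (All.tabulate λ U∈Us → proj₂ (proj₂ (∈-filter⁻ (between? K D) {xs = L} U∈Us)))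
    ; maximum   = λ cU K⊆U U⊆D →
        ∈⇒⊆-foldr-∪ (∈-filter⁺ (between? K D) (connected⇒∈L (K⊆U k∈K) cU) (K⊆U , U⊆D))
    }
    where
    Us = filter (between? K D) L

  module _ {K D R : Subset n} (R-largest : Largest K D R) where
    open Largest R-largest

    largest-absorbs : ∀ {u y} → u ∈ R → y ∈ D → adj G u y ≡ true → y ∈ R
    largest-absorbs {y = y} u∈R y∈D uy =
      maximum (connected-∪-edge G connected (connected-⁅⁆ G y) u∈R (x∈⁅x⁆ y) uy)
              (p⊆p∪q ⁅ y ⁆ ∘ K⊆R) (∪-least R⊆D (x∈p⇒⁅x⁆⊆p y∈D)) (q⊆p∪q R ⁅ y ⁆ (x∈⁅x⁆ y))

    mass-largest : ∀ w → mass w K D ≡ mass w K R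
    mass-largest w = sumWhere-cong (between? K D) (between? K R) w L λ U∈L →
      mk⇔ (λ (K⊆U , U⊆D) → K⊆U , maximum (∈L⇒connected U∈L) K⊆U U⊆D)
          (λ (K⊆U , U⊆R) → K⊆U , R⊆D ∘ U⊆R)

  N-≤-∪ : ∀ {K R Q D k x} → k ∈ K → adj G k x ≡ true → Connected Q → x ∈ Q →
          (∀ {z} → z ∈ Q → z ∉ R) → R ∪ Q ⊆ D → N K R ≤ N (K ∪ Q) D
  N-≤-∪ {K} {R} {Q} {D} k∈K kx cQ x∈Q Q#R R∪Q⊆D =
    countWhere-≤-injection (between? K R) (between? (K ∪ Q) D) (_∪ Q) L-unique maps-to injective
    where
    maps-to : ∀ {U} → U ∈ₗ L → Between K R U → U ∪ Q ∈ₗ L × Between (K ∪ Q) D (U ∪ Q)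
    maps-to {U} U∈L (K⊆U , U⊆R) =
      connected⇒∈L (p⊆p∪q Q (K⊆U k∈K)) (connected-∪-edge G (∈L⇒connected U∈L) cQ (K⊆U k∈K) x∈Q kx) ,
      ∪-least (p⊆p∪q Q ∘ K⊆U) (q⊆p∪q U Q) ,
      ∪-least (R∪Q⊆D ∘ p⊆p∪q Q ∘ U⊆R) (R∪Q⊆D ∘ q⊆p∪q R Q)
    injective : ∀ {U V} → U ∈ₗ L → V ∈ₗ L → Between K R U → Between K R V → U ∪ Q ≡ V ∪ Q → U ≡ V
    injective _ _ (_ , U⊆R) (_ , V⊆R) U∪Q≡V∪Q =
      ⊆-antisym (p∪r≡q∪r⇒p⊆q U∪Q≡V∪Q λ z∈U z∈Q → Q#R z∈Q (U⊆R z∈U))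
                (p∪r≡q∪r⇒p⊆q (sym U∪Q≡V∪Q) λ z∈V z∈Q → Q#R z∈Q (V⊆R z∈V))

  module _ {K D R : Subset n} {k x : Fin n} (cD : Connected D) (R-largest : Largest K (D - x) R)
           (k∈K : k ∈ K) (kx : adj G k x ≡ true) where
    open Largest R-largest using () renaming (R⊆D to R⊆D-x)

    -- (1 + ∣ D ∣ − ∣ R ∣ − ∣ Q ∣) · N K R ≤ N (K ∪ Q) D, with the subtractions moved across.
    ChainBound : Subset n → Set
    ChainBound Q = suc ∣ D ∣ * N K R ≤ N (K ∪ Q) D + (∣ R ∣ + ∣ Q ∣) * N K R

    R∪Q⊆D : ∀ {Q} → Q ⊆ D ─ R → R ∪ Q ⊆ D
    R∪Q⊆D Q⊆D─R = ∪-least (p─q⊆p D ⁅ x ⁆ ∘ R⊆D-x) (p─q⊆p D R ∘ Q⊆D─R)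

    chain-end : ∀ {Q} → Connected Q → x ∈ Q → Q ⊆ D ─ R → D ⊆ R ∪ Q → ChainBound Q
    chain-end {Q} cQ x∈Q Q⊆D─R D⊆R∪Q =
      +-mono-≤ (N-≤-∪ k∈K kx cQ x∈Q (x∈p─q⇒x∉q D R ∘ Q⊆D─R) (R∪Q⊆D Q⊆D─R))
               (*-monoˡ-≤ (N K R) (≤-trans (p⊆q⇒∣p∣≤∣q∣ D⊆R∪Q) (∣p∪q∣≤∣p∣+∣q∣ R Q)))

    chain-step : ∀ {Q y} → Connected Q → x ∈ Q → Q ⊆ D ─ R → y ∉ R ∪ Q → y ∈ D →
                 ChainBound (Q ∪ ⁅ y ⁆) → ChainBound Q
    chain-step {Q} {y} cQ x∈Q Q⊆D─R y∉R∪Q y∈D bound = begin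
      suc ∣ D ∣ * a                                   ≤⟨ bound ⟩
      N K+Q+y D + (∣ R ∣ + ∣ Q ∪ ⁅ y ⁆ ∣) * a           ≤⟨ +-monoʳ-≤ _ (*-monoˡ-≤ a (+-monoʳ-≤ ∣ R ∣ ∣Q∪y∣≤1+∣Q∣)) ⟩
      N K+Q+y D + (∣ R ∣ + suc ∣ Q ∣) * a               ≡⟨ cong (λ m → N K+Q+y D + m * a) (+-suc ∣ R ∣ ∣ Q ∣) ⟩
      N K+Q+y D + (a + (∣ R ∣ + ∣ Q ∣) * a)             ≡⟨ +-assoc (N K+Q+y D) a _ ⟨
      N K+Q+y D + a + (∣ R ∣ + ∣ Q ∣) * a               ≤⟨ +-monoˡ-≤ _ (+-monoʳ-≤ (N K+Q+y D) a≤) ⟩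
      N K+Q+y D + N (K ∪ Q) (D - y) + (∣ R ∣ + ∣ Q ∣) * a ≡⟨ cong (_+ (∣ R ∣ + ∣ Q ∣) * a) split ⟨
      N (K ∪ Q) D + (∣ R ∣ + ∣ Q ∣) * a                 ∎
      where
      open ≤-Reasoning
      a = N K R
      K+Q+y = K ∪ (Q ∪ ⁅ y ⁆)
      split : N (K ∪ Q) D ≡ N K+Q+y D + N (K ∪ Q) (D - y)
      split = trans (mass-split (λ _ → 1) (K ∪ Q) D y) (cong (λ T → N T D + N (K ∪ Q) (D - y)) (∪-assoc K Q ⁅ y ⁆))
      ∣Q∪y∣≤1+∣Q∣ : ∣ Q ∪ ⁅ y ⁆ ∣ ≤ suc ∣ Q ∣
      ∣Q∪y∣≤1+∣Q∣ = ≤-trans (∣p∪q∣≤∣p∣+∣q∣ Q ⁅ y ⁆) (≤-reflexive (trans (cong (∣ Q ∣ +_) (∣⁅x⁆∣≡1 y)) (+-comm ∣ Q ∣ 1)))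
      a≤ : a ≤ N (K ∪ Q) (D - y)
      a≤ = N-≤-∪ k∈K kx cQ x∈Q (x∈p─q⇒x∉q D R ∘ Q⊆D─R)
             (λ z∈R∪Q → x∈p∧x≢y⇒x∈p-y (R∪Q⊆D Q⊆D─R z∈R∪Q) λ { refl → y∉R∪Q z∈R∪Q })

    chain-bound : ∀ {Q} → Acc _⊃_ Q → Connected Q → x ∈ Q → Q ⊆ D ─ R → ChainBound Q
    chain-bound {Q} (acc larger) cQ x∈Q Q⊆D─R
      with ⊆-or-exit G cD (q⊆p∪q R Q x∈Q) (p─q⊆p D R (Q⊆D─R x∈Q))
    ... | inj₁ D⊆R∪Q = chain-end cQ x∈Q Q⊆D─R D⊆R∪Q
    ... | inj₂ (exit {u} {y} u∈R∪Q y∉R∪Q y∈D uy) with x∈p∪q⁻ R Q u∈R∪Q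
    ... | inj₁ u∈R = ⊥-elim (y∉R∪Q (p⊆p∪q Q (largest-absorbs R-largest u∈R y∈D-x uy)))
      where
      y∈D-x : y ∈ D - x
      y∈D-x = x∈p∧x≢y⇒x∈p-y y∈D λ { refl → y∉R∪Q (q⊆p∪q R Q x∈Q) }
    ... | inj₂ u∈Q = chain-step cQ x∈Q Q⊆D─R y∉R∪Q y∈D
      (chain-bound (larger (p⊂p∪⁅x⁆ (y∉R∪Q ∘ q⊆p∪q R Q)))
                   (connected-∪-edge G cQ (connected-⁅⁆ G y) u∈Q (x∈⁅x⁆ y) uy)
                   (p⊆p∪q ⁅ y ⁆ x∈Q)
                   (∪-least Q⊆D─R (x∈p⇒⁅x⁆⊆p (x∈p∧x∉q⇒x∈p─q y∈D (y∉R∪Q ∘ p⊆p∪q Q)))))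

    cross-bound : x ∈ D → ∣ D ∣ * N K R ≤ N (K ∪ ⁅ x ⁆) D + ∣ R ∣ * N K R
    cross-bound x∈D = +-cancelˡ-≤ a _ _ (begin
      a + ∣ D ∣ * a                  ≤⟨ chain-bound (⊃-wellFounded _) (connected-⁅⁆ G x) (x∈⁅x⁆ x) ⁅x⁆⊆D─R ⟩
      N K+x D + (∣ R ∣ + ∣ ⁅ x ⁆ ∣) * a ≡⟨ cong (λ m → N K+x D + (∣ R ∣ + m) * a) (∣⁅x⁆∣≡1 x) ⟩
      N K+x D + (∣ R ∣ + 1) * a       ≡⟨ cong (λ m → N K+x D + m * a) (+-comm ∣ R ∣ 1) ⟩
      N K+x D + (a + ∣ R ∣ * a)       ≡⟨ x∙yz≈y∙xz (N K+x D) a _ ⟩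
      a + (N K+x D + ∣ R ∣ * a)       ∎)
      where
      open ≤-Reasoning
      a = N K R
      K+x = K ∪ ⁅ x ⁆
      ⁅x⁆⊆D─R : ⁅ x ⁆ ⊆ D ─ R
      ⁅x⁆⊆D─R = x∈p⇒⁅x⁆⊆p (x∈p∧x∉q⇒x∈p─q x∈D (p⊆q-x⇒x∉p R⊆D-x))

  mean-bound-combine : ∀ {a a′ d r nb na sb sa} → a < a′ →
                       (a′ + d) * nb ≤ 2 * sb → (a + r) * na ≤ 2 * sa → d * na ≤ nb + r * na →
                       (a + d) * (nb + na) ≤ 2 * (sb + sa)
  mean-bound-combine {a} {a′} {d} {r} {nb} {na} {sb} {sa} a<a′ bound₁ bound₂ cross = begin
    (a + d) * (nb + na)                     ≡⟨ *-distribˡ-+ (a + d) nb na ⟩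
    (a + d) * nb + (a + d) * na             ≡⟨ cong ((a + d) * nb +_) (*-distribʳ-+ na a d) ⟩
    (a + d) * nb + (a * na + d * na)        ≤⟨ +-monoʳ-≤ ((a + d) * nb) (+-monoʳ-≤ (a * na) cross) ⟩
    (a + d) * nb + (a * na + (nb + r * na)) ≡⟨ regroup a d r nb na ⟩
    (suc a + d) * nb + (a + r) * na         ≤⟨ +-monoˡ-≤ ((a + r) * na) (*-monoˡ-≤ nb (+-monoˡ-≤ d a<a′)) ⟩
    (a′ + d) * nb + (a + r) * na            ≤⟨ +-mono-≤ bound₁ bound₂ ⟩
    2 * sb + 2 * sa                         ≡⟨ *-distribˡ-+ 2 sb sa ⟨
    2 * (sb + sa)                           ∎
    where
    open ≤-Reasoning
    regroup : ∀ a d r nb na → (a + d) * nb + (a * na + (nb + r * na)) ≡ (1 + a + d) * nb + (a + r) * na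
    regroup = solve-∀

  mean-bound-acc : ∀ {D} → Acc _⊂_ D → Connected D → ∀ {K k} → Acc _⊃_ K → k ∈ K → Connected K → K ⊆ D →
                   (∣ K ∣ + ∣ D ∣) * N K D ≤ 2 * S K D
  mean-bound-acc {D} (acc smaller) cD = grow
    where
    grow : ∀ {K k} → Acc _⊃_ K → k ∈ K → Connected K → K ⊆ D → (∣ K ∣ + ∣ D ∣) * N K D ≤ 2 * S K D
    grow {K} (acc larger) k∈K cK K⊆D with ⊆-or-exit G cD k∈K (K⊆D k∈K)
    ... | inj₁ D⊆K = mean-bound-⊇ D⊆K
    ... | inj₂ (exit {u} {x} u∈K x∉K x∈D ux) = begin
      (∣ K ∣ + ∣ D ∣) * N K D             ≡⟨ cong ((∣ K ∣ + ∣ D ∣) *_) (split (λ _ → 1)) ⟩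
      (∣ K ∣ + ∣ D ∣) * (N K+x D + N K R) ≤⟨ mean-bound-combine {sb = S K+x D} {sa = S K R}
                                             (p⊂q⇒∣p∣<∣q∣ (p⊂p∪⁅x⁆ x∉K)) bound-K+x bound-R
                                             (cross-bound cD R-largest u∈K ux x∈D) ⟩
      2 * (S K+x D + S K R)               ≡⟨ cong (2 *_) (split ∣_∣) ⟨
      2 * S K D                           ∎
      where
      open ≤-Reasoning
      R-exists = largest k∈K cK (p⊆q⇒p⊆q-x K⊆D x∉K)
      R = proj₁ R-exists
      R-largest = proj₂ R-exists
      open Largest R-largest
      K+x = K ∪ ⁅ x ⁆
      split : ∀ w → mass w K D ≡ mass w K+x D + mass w K R
      split w = trans (mass-split w K D x) (cong (mass w K+x D +_) (mass-largest R-largest w))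
      bound-K+x : (∣ K+x ∣ + ∣ D ∣) * N K+x D ≤ 2 * S K+x D
      bound-K+x = grow (larger (p⊂p∪⁅x⁆ x∉K)) (p⊆p∪q ⁅ x ⁆ k∈K)
                    (connected-∪-edge G cK (connected-⁅⁆ G x) u∈K (x∈⁅x⁆ x) ux) (∪-least K⊆D (x∈p⇒⁅x⁆⊆p x∈D))
      bound-R : (∣ K ∣ + ∣ R ∣) * N K R ≤ 2 * S K R
      bound-R = mean-bound-acc (smaller (p⊆q-x⇒p⊂q R⊆D x∈D)) connected (⊃-wellFounded K) k∈K cK K⊆R

  mean-bound : ∀ {K D k} → k ∈ K → Connected K → Connected D → K ⊆ D → (∣ K ∣ + ∣ D ∣) * N K D ≤ 2 * S K D
  mean-bound {K} {D} k∈K cK cD = mean-bound-acc (⊂-wellFounded D) cD (⊃-wellFounded K) k∈K cK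

  local-mean-bound : Connected ⊤ → ∀ v → (n + 1) * N ⁅ v ⁆ ⊤ ≤ 2 * S ⁅ v ⁆ ⊤
  local-mean-bound c⊤ v =
    subst (λ m → m * N ⁅ v ⁆ ⊤ ≤ 2 * S ⁅ v ⁆ ⊤) (trans (cong₂ _+_ (∣⁅x⁆∣≡1 v) (∣⊤∣≡n n)) (+-comm 1 n))
          (mean-bound (x∈⁅x⁆ v) (connected-⁅⁆ G v) c⊤ ⊆⊤)

  sizes-by-vertex : (w : Subset n → ℕ) →
                    sum (map (λ U → ∣ U ∣ * w U) L) ≡ sum (map (λ v → mass w ⁅ v ⁆ ⊤) (allFin n))
  sizes-by-vertex w = begin
    sum (map (λ U → ∣ U ∣ * w U) L)
      ≡⟨ sum-map-cong L (λ {U} _ → cong (_* w U) (∣p∣≡Σ𝟙[∈p] U)) ⟩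
    sum (map (λ U → sum (map (λ v → 𝟙 (v ∈? U)) (allFin n)) * w U) L)
      ≡⟨ sum-map-cong L (λ {U} _ → sum-map-* (w U) (allFin n) _) ⟩
    sum (map (λ U → sum (map (λ v → 𝟙 (v ∈? U) * w U) (allFin n))) L)
      ≡⟨ sum-map-comm L (allFin n) _ ⟩
    sum (map (λ v → sumWhere (v ∈?_) w L) (allFin n))
      ≡⟨ sum-map-cong (allFin n) (λ {v} _ → sumWhere-cong (v ∈?_) (between? ⁅ v ⁆ ⊤) w L λ _ → v∈U⇔) ⟩
    sum (map (λ v → mass w ⁅ v ⁆ ⊤) (allFin n))
      ∎
    where
    open ≡-Reasoning
    v∈U⇔ : ∀ {v U} → v ∈ U ⇔ Between ⁅ v ⁆ ⊤ U
    v∈U⇔ {v} {U} = mk⇔ {A = v ∈ U} {B = Between ⁅ v ⁆ ⊤ U}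
                       (λ v∈U → x∈p⇒⁅x⁆⊆p v∈U , ⊆⊤) (λ (⁅v⁆⊆U , _) → ⁅v⁆⊆U (x∈⁅x⁆ v))

corollary2p2 : (n : ℕ) (G : Graph n) → ConnectedGraph G →
    (L : List (Subset n)) → Enumerates G L →
    (n + 1) * sumSizes L ≤ 2 * sumSqSizes L
corollary2p2 n G conn L (L-unique , L-exact) = begin
  (n + 1) * sumSizes L                             ≡⟨ cong ((n + 1) *_) sumSizes≡ΣN ⟩
  (n + 1) * sum (map (λ v → N ⁅ v ⁆ ⊤) (allFin n)) ≡⟨ *-sum-map (n + 1) (allFin n) _ ⟩
  sum (map (λ v → (n + 1) * N ⁅ v ⁆ ⊤) (allFin n)) ≤⟨ sum-map-mono (allFin n) (λ {v} _ → local-mean-bound conn v) ⟩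
  sum (map (λ v → 2 * S ⁅ v ⁆ ⊤) (allFin n))       ≡⟨ *-sum-map 2 (allFin n) _ ⟨
  2 * sum (map (λ v → S ⁅ v ⁆ ⊤) (allFin n))       ≡⟨ cong (2 *_) (sizes-by-vertex ∣_∣) ⟨
  2 * sumSqSizes L                                 ∎
  where
  open ConnectedSets G L L-unique L-exact
  open ≤-Reasoning
  sumSizes≡ΣN : sumSizes L ≡ sum (map (λ v → N ⁅ v ⁆ ⊤) (allFin n))
  sumSizes≡ΣN = trans (sum-map-cong L λ {U} _ → sym (*-identityʳ ∣ U ∣)) (sizes-by-vertex (λ _ → 1))
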